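{- Let $k\ge 3$ and let $G$ be a $k$-regular graph. For every strong edge coloring $\sigma$ of $G$ with colors $\{1,\dots,2k-1\}$, the map $f_\sigma$ sending each vertex $v$ of $G$ to the $(k-1)$-element set of colors not occurring on the edges incident with $v$ is a covering projection $f_\sigma\colon G\to K(2k-1,k-1)$ (and this is the covering projection determined by $\sigma$). Moreover, two such colorings $\sigma$ and $\tau$ are equivalent if and only if the covering projections $f_\sigma$ and $f_\tau$ are equivalent.
   Context: A strong edge coloring is a proper edge coloring with no bichromatic path of length three. The Kneser graph $K(2k-1,k-1)$ has as vertices the $(k-1)$-subsets of $\{1,\dots,2k-1\}$, adjacent iff disjoint. A surjective homomorphism $f\colon\tilde G\to H$ is a covering projection if for every vertex $\tilde v$ the edges incident with $\tilde v$ are mapped bijectively onto the edges incident with $f(\tilde v)$. Two edge colorings $\phi_1,\phi_2$ of $G$ are equivalent if there is an automorphism $\alpha$ of $G$ with $\phi_2(e)=\phi_1(\alpha(e))$ for every edge $e$. Two covering projections $f_1,f_2\colon G\to H$ are equivalent if there is an automorphism $\beta$ of $G$ with $f_2=f_1\circ\beta$. -}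

module Defs where

open import Data.Nat using (ℕ; _∸_; _*_; _≡ᵇ_)
open import Data.Bool using (Bool; true; false; T; not; _∧_)
open import Data.Fin using (Fin; _≟_)
open import Data.Fin.Subset using (Subset; ∣_∣; _∩_)
open import Data.Vec using (tabulate)
open import Data.List using (allFin)
open import Data.Bool.ListAction using (any)
open import Data.Product using (Σ; Σ-syntax; _×_; _,_; proj₁)
open import Data.Sum using (_⊎_)
open import Relation.Binary.PropositionalEquality using (_≡_; _≢_)
open import Relation.Nullary using (¬_)
open import Relation.Nullary.Decidable using (⌊_⌋)
open import Function.Definitions using (Bijective; Surjective)

record FinGraph (n : ℕ) : Set where
  field
    adj        : Fin n → Fin n → Bool
    adj-sym    : ∀ u v → adj u v ≡ adj v u
    adj-irrefl : ∀ v → adj v v ≡ false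
open FinGraph public

nbhd : ∀ {n} → FinGraph n → Fin n → Subset n
nbhd G v = tabulate (adj G v)

deg : ∀ {n} → FinGraph n → Fin n → ℕ
deg G v = ∣ nbhd G v ∣

Regular : ∀ {n} → ℕ → FinGraph n → Set
Regular k G = ∀ v → deg G v ≡ k

-- An edge colouring with colours Fin m: a function on ordered pairs,
-- symmetric on edges (its values on non-edges are irrelevant).
Colouring : ℕ → ℕ → Set
Colouring n m = Fin n → Fin n → Fin m

IsEdgeColouring : ∀ {n m} → FinGraph n → Colouring n m → Set
IsEdgeColouring G σ = ∀ u v → T (adj G u v) → σ u v ≡ σ v u

Proper : ∀ {n m} → FinGraph n → Colouring n m → Set
Proper G σ = ∀ u v w → T (adj G u v) → T (adj G v w) → u ≢ w → σ u v ≢ σ v w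

ExactlyTwo : ∀ {m} → Fin m → Fin m → Fin m → Set
ExactlyTwo a b c = (a ≡ b × b ≢ c) ⊎ (b ≡ c × a ≢ b) ⊎ (a ≡ c × a ≢ b)

BichromaticP3 : ∀ {n m} → FinGraph n → Colouring n m → Set
BichromaticP3 {n} G σ =
  Σ[ u ∈ Fin n ] Σ[ v ∈ Fin n ] Σ[ w ∈ Fin n ] Σ[ x ∈ Fin n ]
    (u ≢ v × u ≢ w × u ≢ x × v ≢ w × v ≢ x × w ≢ x) ×
    T (adj G u v) × T (adj G v w) × T (adj G w x) ×
    ExactlyTwo (σ u v) (σ v w) (σ w x)

StrongEdgeColouring : ∀ {n m} → FinGraph n → Colouring n m → Set
StrongEdgeColouring G σ =
  IsEdgeColouring G σ × Proper G σ × ¬ BichromaticP3 G σ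

Automorphism : ∀ {n} → FinGraph n → (Fin n → Fin n) → Set
Automorphism G α =
  Bijective _≡_ _≡_ α × (∀ u v → adj G u v ≡ adj G (α u) (α v))

EquivColourings : ∀ {n m} → FinGraph n → Colouring n m → Colouring n m → Set
EquivColourings {n} G σ τ =
  Σ[ α ∈ (Fin n → Fin n) ] Automorphism G α ×
    (∀ u v → T (adj G u v) → τ u v ≡ σ (α u) (α v))

-- Kneser graph K(2k-1, k-1): vertices are (k-1)-subsets of Fin (2k-1),
-- adjacent iff disjoint.
KV : ℕ → Set
KV k = Σ[ s ∈ Subset (2 * k ∸ 1) ] ∣ s ∣ ≡ k ∸ 1

Kadj : (k : ℕ) → KV k → KV k → Bool
Kadj k s t = ∣ proj₁ s ∩ proj₁ t ∣ ≡ᵇ 0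

module _ {n : ℕ} (G : FinGraph n) {W : Set} (adjW : W → W → Bool) where

  Nbr : Fin n → Set
  Nbr v = Σ[ u ∈ Fin n ] T (adj G v u)

  NbrW : W → Set
  NbrW w = Σ[ w' ∈ W ] T (adjW w w')

  record IsCovering (f : Fin n → W) : Set where
    field
      hom        : ∀ u v → T (adj G u v) → T (adjW (f u) (f v))
      surjective : Surjective _≡_ _≡_ f
      localBij   : ∀ v → Bijective {A = Nbr v} {B = NbrW (f v)} _≡_ _≡_
                           (λ { (u , p) → (f u , hom v u p) })

EquivCoverings : ∀ {n} {W : Set} → FinGraph n → (Fin n → W) → (Fin n → W) → Set
EquivCoverings {n} G f g =
  Σ[ β ∈ (Fin n → Fin n) ] Automorphism G β × (∀ v → g v ≡ f (β v))

missing : ∀ {n m} → FinGraph n → Colouring n m → Fin n → Subset m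
missing {n} G σ v =
  tabulate (λ c → not (any (λ u → adj G v u ∧ ⌊ σ v u ≟ c ⌋) (allFin n)))

{-# OPTIONS --safe #-}
-- Let C(v) be the set of colours at v, so that missing v is its complement. Properness and
-- k-regularity give |C(v)| = k. For an edge vu, σ(vu) is the only colour in C(v) ∩ C(u):
-- any other one would lie on a bichromatic path of length three through vu. Hence C(v) and
-- C(u) - σ(vu) partition the 2k - 1 colours, so adjacent vertices have disjoint missing
-- sets, and the missing sets of the neighbours of v are the k sets C(v) - c, which are
-- exactly the Kneser neighbours of missing v. A walk v - u - w exchanges one missing colour
-- for another, so every (k-1)-set is reached. Both notions of equivalence amount to
-- C_τ = C_σ ∘ β, and C determines the colouring by the shared-colour property.
module Submission where

open import Defs
open import Data.Nat using (ℕ; zero; suc; _+_; _*_; _∸_; _≤_; s≤s; z≤n)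
open import Data.Nat.Properties
  using (+-suc; +-comm; +-identityʳ; m+n∸m≡n; m∸n≤m; ∸-monoʳ-<; <⇒≢; ≤⇒≯; ≤-reflexive; ≤-trans;
         ≡ᵇ⇒≡; ≡⇒≡ᵇ)
  renaming (≡-irrelevant to ℕ-≡-irrelevant)
open import Data.Bool using (Bool; T; not; _∧_) renaming (_≟_ to _≟ᵇ_)
open import Data.Bool.Properties using (T-≡; T-∧; T-irrelevant; not-involutive)
open import Data.Bool.ListAction using (any)
open import Data.Fin using (Fin; zero; suc; _≟_)
open import Data.Fin.Properties using (0≢1+n) renaming (suc-injective to Fin-suc-injective)
open import Data.Fin.Subset
open import Data.Fin.Subset.Properties
open import Data.Fin.Subset.Induction using (⊂-wellFounded; Acc; acc)
open import Data.Vec using ([]; _∷_; here; there; tabulate)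
open import Data.Vec.Properties using (lookup∘tabulate; []=⇒lookup; lookup⇒[]=; tabulate-∘; ≡-dec)
open import Data.List using (allFin)
open import Data.List.Membership.Propositional using (lose)
open import Data.List.Membership.Propositional.Properties using (∈-allFin)
open import Data.List.Relation.Unary.Any using (satisfied)
open import Data.List.Relation.Unary.Any.Properties using (any⁺; any⁻)
open import Data.Product using (Σ; Σ-syntax; ∃-syntax; _×_; _,_; proj₁; proj₂)
open import Data.Sum using (inj₁; inj₂)
open import Function using (_∘_; _⇔_; mk⇔; Equivalence)
open import Function.Definitions using (Injective; Surjective)
open import Function.Consequences.Propositional using (strictlySurjective⇒surjective)
open import Relation.Binary.PropositionalEquality
  using (_≡_; _≢_; refl; sym; trans; cong; cong₂; subst; subst₂; module ≡-Reasoning)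
open import Relation.Nullary using (¬_; yes; no; Irrelevant)
open import Relation.Nullary.Decidable using (⌊_⌋; toWitness; fromWitness)
open import Relation.Nullary.Negation using (contradiction)

open Equivalence using (to; from)

private
  variable
    n m : ℕ
    p q : Subset n
    x y : Fin n

Empty⇒∣p∣≡0 : Empty p → ∣ p ∣ ≡ 0
Empty⇒∣p∣≡0 {n} p-empty = trans (cong ∣_∣ (Empty-unique p-empty)) (∣⊥∣≡0 n)

∣p∣≡0⇒Empty : ∣ p ∣ ≡ 0 → Empty p
∣p∣≡0⇒Empty {p = outside ∷ p} ∣p∣≡0 (suc x , there x∈p) = ∣p∣≡0⇒Empty ∣p∣≡0 (x , x∈p)
∣p∣≡0⇒Empty {p = inside ∷ p}  ()

x∈p─q⇒x∉q : ∀ (p q : Subset n) → x ∈ p ─ q → x ∉ q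
x∈p─q⇒x∉q (_ ∷ p) (outside ∷ q) here          ()
x∈p─q⇒x∉q (_ ∷ p) (_       ∷ q) (there x∈p─q) (there x∈q) = x∈p─q⇒x∉q p q x∈p─q x∈q

x∈p-y⇒x≢y : x ∈ p - y → x ≢ y
x∈p-y⇒x≢y {p = p} {y = y} x∈p-y refl = x∈p─q⇒x∉q p ⁅ y ⁆ x∈p-y (x∈⁅x⁆ y)

Empty[p─q]⇒p⊆q : Empty (p ─ q) → p ⊆ q
Empty[p─q]⇒p⊆q {q = q} p─q-empty {x} x∈p with x ∈? q
... | yes x∈q = x∈q
... | no  x∉q = contradiction (x , x∈p∧x∉q⇒x∈p─q x∈p x∉q) p─q-empty

∣p∣≡1+∣p-x∣ : x ∈ p → ∣ p ∣ ≡ suc ∣ p - x ∣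
∣p∣≡1+∣p-x∣ {p = inside  ∷ p} here        = cong (suc ∘ ∣_∣) (sym (p─⊥≡p p))
∣p∣≡1+∣p-x∣ {p = inside  ∷ p} (there x∈p) = cong suc (∣p∣≡1+∣p-x∣ x∈p)
∣p∣≡1+∣p-x∣ {p = outside ∷ p} (there x∈p) = ∣p∣≡1+∣p-x∣ x∈p

∣p∪q∣≡∣p∣+∣q∣ : Empty (p ∩ q) → ∣ p ∪ q ∣ ≡ ∣ p ∣ + ∣ q ∣
∣p∪q∣≡∣p∣+∣q∣ {p = []}          {[]}          _ = refl
∣p∪q∣≡∣p∣+∣q∣ {p = inside  ∷ p} {inside  ∷ q} p∩q-empty = contradiction (zero , here) p∩q-empty
∣p∪q∣≡∣p∣+∣q∣ {p = inside  ∷ p} {outside ∷ q} p∩q-empty =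
  cong suc (∣p∪q∣≡∣p∣+∣q∣ (drop-∷-Empty p∩q-empty))
∣p∪q∣≡∣p∣+∣q∣ {p = outside ∷ p} {inside  ∷ q} p∩q-empty =
  trans (cong suc (∣p∪q∣≡∣p∣+∣q∣ (drop-∷-Empty p∩q-empty))) (sym (+-suc ∣ p ∣ ∣ q ∣))
∣p∪q∣≡∣p∣+∣q∣ {p = outside ∷ p} {outside ∷ q} p∩q-empty = ∣p∪q∣≡∣p∣+∣q∣ (drop-∷-Empty p∩q-empty)

p⊆q⇒∣q∣≤∣p∣⇒p≡q : p ⊆ q → ∣ q ∣ ≤ ∣ p ∣ → p ≡ q
p⊆q⇒∣q∣≤∣p∣⇒p≡q {p = p} p⊆q ∣q∣≤∣p∣ = ⊆-antisym p⊆q q⊆p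
  where
  q⊆p : _ ⊆ p
  q⊆p {x} x∈q with x ∈? p
  ... | yes x∈p = x∈p
  ... | no  x∉p = contradiction (p⊂q⇒∣p∣<∣q∣ (p⊆q , x , x∈q , x∉p)) (≤⇒≯ ∣q∣≤∣p∣)

p≢q⇒∣q∣≤∣p∣⇒Nonempty[p─q] : p ≢ q → ∣ q ∣ ≤ ∣ p ∣ → Nonempty (p ─ q)
p≢q⇒∣q∣≤∣p∣⇒Nonempty[p─q] {p = p} {q} p≢q ∣q∣≤∣p∣ with nonempty? (p ─ q)
... | yes p─q-nonempty = p─q-nonempty
... | no  p─q-empty    = contradiction (p⊆q⇒∣q∣≤∣p∣⇒p≡q (Empty[p─q]⇒p⊆q p─q-empty) ∣q∣≤∣p∣) p≢q

InjectiveOn : (Fin n → Fin m) → Subset n → Set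
InjectiveOn g p = ∀ {i j} → i ∈ p → j ∈ p → g i ≡ g j → i ≡ j

IsImage : (Fin n → Fin m) → Subset n → Subset m → Set
IsImage g p q = ∀ {c} → c ∈ q ⇔ (∃[ i ] i ∈ p × g i ≡ c)

InjectiveOn-tail : ∀ {s} {g : Fin (suc n) → Fin m} → InjectiveOn g (s ∷ p) → InjectiveOn (g ∘ suc) p
InjectiveOn-tail g-inj i∈p j∈p e = Fin-suc-injective (g-inj (there i∈p) (there j∈p) e)

∣image∣≡∣p∣ : ∀ {p : Subset n} {q : Subset m} (g : Fin n → Fin m) →
              InjectiveOn g p → IsImage g p q → ∣ q ∣ ≡ ∣ p ∣
∣image∣≡∣p∣ {p = []} g _ q≡g[p] = Empty⇒∣p∣≡0 λ { (c , c∈q) → no-preimage (to q≡g[p] c∈q) }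
  where no-preimage : ∀ {c} → ¬ (∃[ i ] i ∈ [] × g i ≡ c)
        no-preimage (() , _)
∣image∣≡∣p∣ {p = outside ∷ p} {q} g g-inj q≡g[p] =
  ∣image∣≡∣p∣ (g ∘ suc) (InjectiveOn-tail g-inj) q≡g∘suc[p]
  where
  preimage : ∀ {c} → ∃[ i ] i ∈ outside ∷ p × g i ≡ c → ∃[ i ] i ∈ p × g (suc i) ≡ c
  preimage (suc i , there i∈p , e) = i , i∈p , e
  q≡g∘suc[p] : IsImage (g ∘ suc) p q
  q≡g∘suc[p] = mk⇔ (preimage ∘ to q≡g[p]) λ { (i , i∈p , e) → from q≡g[p] (suc i , there i∈p , e) }
∣image∣≡∣p∣ {p = inside ∷ p} {q} g g-inj q≡g[p] = begin
  ∣ q ∣               ≡⟨ ∣p∣≡1+∣p-x∣ (from q≡g[p] (zero , here , refl)) ⟩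
  suc ∣ q - g zero ∣  ≡⟨ cong suc (∣image∣≡∣p∣ (g ∘ suc) (InjectiveOn-tail g-inj) q-g₀≡g∘suc[p]) ⟩
  suc ∣ p ∣           ∎
  where
  open ≡-Reasoning
  g₀≢g[suc] : ∀ {i} → i ∈ p → g zero ≢ g (suc i)
  g₀≢g[suc] i∈p e = 0≢1+n (g-inj here (there i∈p) e)
  preimage : ∀ {c} → c ≢ g zero → ∃[ i ] i ∈ inside ∷ p × g i ≡ c → ∃[ i ] i ∈ p × g (suc i) ≡ c
  preimage c≢g₀ (zero  , _         , e) = contradiction (sym e) c≢g₀
  preimage c≢g₀ (suc i , there i∈p , e) = i , i∈p , e
  q-g₀≡g∘suc[p] : IsImage (g ∘ suc) p (q - g zero)
  q-g₀≡g∘suc[p] = mk⇔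
    (λ c∈q-g₀ → preimage (x∈p-y⇒x≢y c∈q-g₀) (to q≡g[p] (p─q⊆p q _ c∈q-g₀)))
    λ { (i , i∈p , refl) →
          x∈p∧x≢y⇒x∈p-y (from q≡g[p] (suc i , there i∈p , refl)) (g₀≢g[suc] i∈p ∘ sym) }

∈-tabulate : ∀ {f : Fin n → Bool} → x ∈ tabulate f ⇔ T (f x)
∈-tabulate {x = x} {f = f} = mk⇔
  (λ x∈ → from T-≡ (trans (sym (lookup∘tabulate f x)) ([]=⇒lookup x∈)))
  (λ fx → lookup⇒[]= x (tabulate f) (trans (lookup∘tabulate f x) (to T-≡ fx)))

∁-involutive : ∀ (p : Subset n) → ∁ (∁ p) ≡ p
∁-involutive []      = refl
∁-involutive (s ∷ p) = cong₂ _∷_ (not-involutive s) (∁-involutive p)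

∁-injective : ∁ p ≡ ∁ q → p ≡ q
∁-injective {p = p} {q} ∁p≡∁q = trans (sym (∁-involutive p)) (trans (cong ∁ ∁p≡∁q) (∁-involutive q))

Σ-≡-irrelevant : ∀ {A : Set} {P : A → Set} → (∀ {a} → Irrelevant (P a)) →
                 {s t : Σ A P} → proj₁ s ≡ proj₁ t → s ≡ t
Σ-≡-irrelevant P-irr {a , _} {.a , _} refl = cong (a ,_) (P-irr _ _)

2k∸1≡k+[k∸1] : ∀ {k} → 1 ≤ k → 2 * k ∸ 1 ≡ k + (k ∸ 1)
2k∸1≡k+[k∸1] {suc r} _ = trans (cong (r +_) (+-identityʳ (suc r))) (+-comm r (suc r))

colours : FinGraph n → Colouring n m → Fin n → Subset m
colours {n} G σ v = tabulate (λ c → any (λ u → adj G v u ∧ ⌊ σ v u ≟ c ⌋) (allFin n))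

missing≡∁colours : ∀ (G : FinGraph n) (σ : Colouring n m) v → missing G σ v ≡ ∁ (colours G σ v)
missing≡∁colours G σ v = tabulate-∘ not _

missing≡⇔colours≡ : ∀ (G : FinGraph n) (σ τ : Colouring n m) u v →
                    missing G σ u ≡ missing G τ v ⇔ colours G σ u ≡ colours G τ v
missing≡⇔colours≡ G σ τ u v = mk⇔
  (λ e → ∁-injective (trans (sym (missing≡∁colours G σ u)) (trans e (missing≡∁colours G τ v))))
  (λ e → trans (missing≡∁colours G σ u) (trans (cong ∁ e) (sym (missing≡∁colours G τ v))))

module Adjacency (G : FinGraph n) where

  adj-swap : ∀ {u v} → T (adj G u v) → T (adj G v u)
  adj-swap {u} {v} = subst T (adj-sym G u v)

  adj⇒≢ : ∀ {u v} → T (adj G u v) → u ≢ v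
  adj⇒≢ {u} uu refl = subst T (adj-irrefl G u) uu

  ∈-nbhd : ∀ {v u} → u ∈ nbhd G v ⇔ T (adj G v u)
  ∈-nbhd = ∈-tabulate

module ColourSets (G : FinGraph n) (σ : Colouring n m) where

  open Adjacency G

  ∈-colours : ∀ {v c} → c ∈ colours G σ v ⇔ (∃[ u ] T (adj G v u) × σ v u ≡ c)
  ∈-colours = mk⇔
    (λ c∈ → let u , vu∧σvu≡c = satisfied (any⁻ _ (allFin n) (to ∈-tabulate c∈))
                vu , σvu≡c = to T-∧ vu∧σvu≡c
            in u , vu , toWitness σvu≡c)
    (λ { (u , vu , σvu≡c) →
         from ∈-tabulate (any⁺ _ (lose (∈-allFin u) (from T-∧ (vu , fromWitness σvu≡c)))) })

  ∈-missing : ∀ {v c} → c ∈ missing G σ v ⇔ c ∉ colours G σ v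
  ∈-missing {v} {c} = mk⇔
    (x∈∁p⇒x∉p ∘ subst (c ∈_) (missing≡∁colours G σ v))
    (subst (c ∈_) (sym (missing≡∁colours G σ v)) ∘ x∉p⇒x∈∁p)

  ∉missing⇒∈colours : ∀ {v c} → c ∉ missing G σ v → c ∈ colours G σ v
  ∉missing⇒∈colours {v} {c} = x∉∁p⇒x∈p ∘ (_∘ subst (c ∈_) (sym (missing≡∁colours G σ v)))

  σvu∈colours-v : ∀ {v u} → T (adj G v u) → σ v u ∈ colours G σ v
  σvu∈colours-v {u = u} vu = from ∈-colours (u , vu , refl)

  σvu∈colours-u : IsEdgeColouring G σ → ∀ {v u} → T (adj G v u) → σ v u ∈ colours G σ u
  σvu∈colours-u symmetric {v} {u} vu =
    from ∈-colours (v , adj-swap vu , symmetric u v (adj-swap vu))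

  module _ (symmetric : IsEdgeColouring G σ) (proper : Proper G σ) where

    σ-injectiveOn-nbhd : ∀ v → InjectiveOn (σ v) (nbhd G v)
    σ-injectiveOn-nbhd v {i} {j} i∈ j∈ σvi≡σvj with i ≟ j
    ... | yes i≡j = i≡j
    ... | no  i≢j = contradiction (trans (symmetric i v (adj-swap vi)) σvi≡σvj)
                                  (proper i v j (adj-swap vi) (to ∈-nbhd j∈) i≢j)
      where vi = to ∈-nbhd i∈

    ∣colours∣≡deg : ∀ v → ∣ colours G σ v ∣ ≡ deg G v
    ∣colours∣≡deg v = ∣image∣≡∣p∣ (σ v) (σ-injectiveOn-nbhd v) (mk⇔
      (λ c∈ → let u , vu , σvu≡c = to ∈-colours c∈ in u , from ∈-nbhd vu , σvu≡c)
      (λ { (u , u∈ , σvu≡c) → from ∈-colours (u , to ∈-nbhd u∈ , σvu≡c) }))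

  module _ (strong : StrongEdgeColouring G σ) where
    private
      symmetric = proj₁ strong
      proper = proj₁ (proj₂ strong)
      no-bichromatic = proj₂ (proj₂ strong)

    shared-colour : ∀ {v u c} → T (adj G v u) →
                    c ∈ colours G σ v → c ∈ colours G σ u → c ≡ σ v u
    shared-colour {v} {u} vu c∈v c∈u with to ∈-colours c∈v | to ∈-colours c∈u
    ... | a , va , refl | b , ub , σub≡σva with a ≟ u | b ≟ v
    ... | yes refl | _        = refl
    ... | no a≢u   | yes refl = trans (sym σub≡σva) (symmetric u v ub)
    ... | no a≢u   | no b≢v  with σ v a ≟ σ v u
    ...   | yes σva≡σvu = σva≡σvu
    ...   | no  σva≢σvu with a ≟ b
    ...     | yes refl = contradiction (sym (trans (symmetric a u (adj-swap ub)) σub≡σva))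
                                       (proper v a u va (adj-swap ub) (adj⇒≢ vu))
    ...     | no  a≢b  = contradiction
      (a , v , u , b ,
       (adj⇒≢ (adj-swap va) , a≢u , a≢b , adj⇒≢ vu , b≢v ∘ sym , adj⇒≢ ub) ,
       adj-swap va , vu , ub ,
       inj₂ (inj₂ (trans (symmetric a v (adj-swap va)) (sym σub≡σva) ,
                   σva≢σvu ∘ trans (sym (symmetric a v (adj-swap va))))))
      no-bichromatic

module Kneser (k : ℕ) where

  KV-≡ : ∀ {s t : KV k} → proj₁ s ≡ proj₁ t → s ≡ t
  KV-≡ = Σ-≡-irrelevant ℕ-≡-irrelevant

  Kadj⁺ : ∀ (s t : KV k) → Empty (proj₁ s ∩ proj₁ t) → T (Kadj k s t)
  Kadj⁺ _ _ s∩t-empty = ≡⇒≡ᵇ _ 0 (Empty⇒∣p∣≡0 s∩t-empty)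

  Kadj⁻ : ∀ (s t : KV k) → T (Kadj k s t) → Empty (proj₁ s ∩ proj₁ t)
  Kadj⁻ _ _ st = ∣p∣≡0⇒Empty (≡ᵇ⇒≡ _ 0 st)

module Covering (k : ℕ) (1≤k : 1 ≤ k) {n : ℕ} (G : FinGraph n) (regular : Regular k G)
                (σ : Colouring n (2 * k ∸ 1)) (strong : StrongEdgeColouring G σ) where

  open Adjacency G
  open ColourSets G σ
  open Kneser k

  private
    symmetric = proj₁ strong
    proper = proj₁ (proj₂ strong)

  ∣colours∣≡k : ∀ v → ∣ colours G σ v ∣ ≡ k
  ∣colours∣≡k v = trans (∣colours∣≡deg symmetric proper v) (regular v)

  ∣missing∣≡k∸1 : ∀ v → ∣ missing G σ v ∣ ≡ k ∸ 1
  ∣missing∣≡k∸1 v = begin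
    ∣ missing G σ v ∣              ≡⟨ cong ∣_∣ (missing≡∁colours G σ v) ⟩
    ∣ ∁ (colours G σ v) ∣          ≡⟨ ∣∁p∣≡n∸∣p∣ (colours G σ v) ⟩
    2 * k ∸ 1 ∸ ∣ colours G σ v ∣  ≡⟨ cong (2 * k ∸ 1 ∸_) (∣colours∣≡k v) ⟩
    2 * k ∸ 1 ∸ k                  ≡⟨ cong (_∸ k) (2k∸1≡k+[k∸1] 1≤k) ⟩
    k + (k ∸ 1) ∸ k                ≡⟨ m+n∸m≡n k (k ∸ 1) ⟩
    k ∸ 1                          ∎
    where open ≡-Reasoning

  missing⊆colours-of-neighbour : ∀ {v u} → T (adj G v u) → missing G σ v ⊆ colours G σ u
  missing⊆colours-of-neighbour {v} {u} vu {c} c∈missing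
    with x∈p∪q⁻ _ _ (subst (c ∈_) (sym (∣p∣≡n⇒p≡⊤ ∣colours[v]∪colours[u]-σvu∣≡2k∸1)) ∈⊤)
    where
    σvu∈u = σvu∈colours-u symmetric vu
    disjoint : Empty (colours G σ v ∩ (colours G σ u - σ v u))
    disjoint (c , c∈) = let c∈v , c∈u-σvu = x∈p∩q⁻ _ _ c∈ in
      x∈p-y⇒x≢y c∈u-σvu (shared-colour strong vu c∈v (p─q⊆p _ _ c∈u-σvu))
    ∣colours[v]∪colours[u]-σvu∣≡2k∸1 : ∣ colours G σ v ∪ (colours G σ u - σ v u) ∣ ≡ 2 * k ∸ 1
    ∣colours[v]∪colours[u]-σvu∣≡2k∸1 = begin
      ∣ colours G σ v ∪ (colours G σ u - σ v u) ∣      ≡⟨ ∣p∪q∣≡∣p∣+∣q∣ disjoint ⟩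
      ∣ colours G σ v ∣ + ∣ colours G σ u - σ v u ∣    ≡⟨ cong₂ _+_ (∣colours∣≡k v)
           (cong (_∸ 1) (trans (sym (∣p∣≡1+∣p-x∣ σvu∈u)) (∣colours∣≡k u))) ⟩
      k + (k ∸ 1)                                     ≡⟨ sym (2k∸1≡k+[k∸1] 1≤k) ⟩
      2 * k ∸ 1                                       ∎
      where open ≡-Reasoning
  ... | inj₁ c∈v     = contradiction c∈v (to ∈-missing c∈missing)
  ... | inj₂ c∈u-σvu = p─q⊆p _ _ c∈u-σvu

  missingVertex : Fin n → KV k
  missingVertex v = missing G σ v , ∣missing∣≡k∸1 v

  hom : ∀ u v → T (adj G u v) → T (Kadj k (missingVertex u) (missingVertex v))
  hom u v uv = Kadj⁺ (missingVertex u) (missingVertex v) λ (c , c∈) →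
    let c∈u , c∈v = x∈p∩q⁻ _ _ c∈ in
    to ∈-missing c∈v (missing⊆colours-of-neighbour uv c∈u)

  edgeMap : ∀ v → Nbr G (Kadj k) v → NbrW G (Kadj k) (missingVertex v)
  edgeMap v (u , vu) = missingVertex u , hom v u vu

  edgeMap-injective : ∀ v → Injective _≡_ _≡_ (edgeMap v)
  edgeMap-injective v {u₁ , vu₁} {u₂ , vu₂} edgeMap≡ = Σ-≡-irrelevant T-irrelevant
    (σ-injectiveOn-nbhd symmetric proper v (from ∈-nbhd vu₁) (from ∈-nbhd vu₂) σvu₁≡σvu₂)
    where
    colours≡ : colours G σ u₁ ≡ colours G σ u₂
    colours≡ = to (missing≡⇔colours≡ G σ σ u₁ u₂) (cong (proj₁ ∘ proj₁) edgeMap≡)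
    σvu₁≡σvu₂ : σ v u₁ ≡ σ v u₂
    σvu₁≡σvu₂ = shared-colour strong vu₂ (σvu∈colours-v vu₁)
                  (subst (σ v u₁ ∈_) colours≡ (σvu∈colours-u symmetric vu₁))

  colours─t-nonempty : ∀ v (t : KV k) → Nonempty (colours G σ v ─ proj₁ t)
  colours─t-nonempty v (t , ∣t∣≡k∸1) = p≢q⇒∣q∣≤∣p∣⇒Nonempty[p─q] colours[v]≢t
    (subst₂ _≤_ (sym ∣t∣≡k∸1) (sym (∣colours∣≡k v)) (m∸n≤m k 1))
    where
    colours[v]≢t : colours G σ v ≢ t
    colours[v]≢t e = <⇒≢ (∸-monoʳ-< {o = 0} (s≤s z≤n) 1≤k)
                         (trans (sym ∣t∣≡k∸1) (trans (cong ∣_∣ (sym e)) (∣colours∣≡k v)))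

  edgeMap-surjective : ∀ v → Surjective _≡_ _≡_ (edgeMap v)
  edgeMap-surjective v = strictlySurjective⇒surjective preimage
    where
    preimage : ∀ s → ∃[ u ] edgeMap v u ≡ s
    preimage ((t , ∣t∣≡k∸1) , vt) with colours─t-nonempty v (t , ∣t∣≡k∸1)
    ... | c , c∈colours[v]─t with to ∈-colours (p─q⊆p _ _ c∈colours[v]─t)
    ... | u , vu , refl = (u , vu) , Σ-≡-irrelevant T-irrelevant (KV-≡ (sym t≡missing[u]))
      where
      t⊆colours[v] : t ⊆ colours G σ v
      t⊆colours[v] x∈t = ∉missing⇒∈colours λ x∈missing →
        Kadj⁻ (missingVertex v) (t , ∣t∣≡k∸1) vt (_ , x∈p∩q⁺ (x∈missing , x∈t))
      t⊆missing[u] : t ⊆ missing G σ u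
      t⊆missing[u] x∈t = from ∈-missing λ x∈colours[u] → x∈p─q⇒x∉q _ _ c∈colours[v]─t
        (subst (_∈ t) (shared-colour strong vu (t⊆colours[v] x∈t) x∈colours[u]) x∈t)
      t≡missing[u] : t ≡ missing G σ u
      t≡missing[u] = p⊆q⇒∣q∣≤∣p∣⇒p≡q t⊆missing[u]
                       (≤-reflexive (trans (∣missing∣≡k∸1 u) (sym ∣t∣≡k∸1)))

  ∃closer : ∀ (t : KV k) v → missing G σ v ≢ proj₁ t →
           ∃[ w ] missing G σ w ─ proj₁ t ⊂ missing G σ v ─ proj₁ t
  ∃closer (t , ∣t∣≡k∸1) v missing[v]≢t
    with p≢q⇒∣q∣≤∣p∣⇒Nonempty[p─q] missing[v]≢t (≤-reflexive same-size)
       | p≢q⇒∣q∣≤∣p∣⇒Nonempty[p─q] (missing[v]≢t ∘ sym) (≤-reflexive (sym same-size))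
    where same-size = trans ∣t∣≡k∸1 (sym (∣missing∣≡k∸1 v))
  ... | y , y∈missing[v]─t | x , x∈t─missing[v]
    with to ∈-colours (∉missing⇒∈colours (x∈p─q⇒x∉q _ _ x∈t─missing[v]))
  ... | u , vu , refl
    with to ∈-colours (missing⊆colours-of-neighbour vu (p─q⊆p _ _ y∈missing[v]─t))
  -- missing w = missing v - y + x, where x = σ v u ∈ t and y = σ u w ∉ t
  ... | w , uw , refl = w , missing[w]─t⊆missing[v]─t , σ u w , y∈missing[v]─t , σuw∉missing[w]─t
    where
    missing[w]─t⊆missing[v]─t : missing G σ w ─ t ⊆ missing G σ v ─ t
    missing[w]─t⊆missing[v]─t {i} i∈missing[w]─t = x∈p∧x∉q⇒x∈p─q (from ∈-missing i∉colours[v]) i∉t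
      where
      i∉t = x∈p─q⇒x∉q _ _ i∈missing[w]─t
      i∈colours[u] = missing⊆colours-of-neighbour (adj-swap uw) (p─q⊆p _ _ i∈missing[w]─t)
      i∉colours[v] : i ∉ colours G σ v
      i∉colours[v] i∈colours[v] =
        i∉t (subst (_∈ t) (sym (shared-colour strong vu i∈colours[v] i∈colours[u]))
                          (p─q⊆p _ _ x∈t─missing[v]))
    σuw∉missing[w]─t : σ u w ∉ missing G σ w ─ t
    σuw∉missing[w]─t σuw∈ = to ∈-missing (p─q⊆p _ _ σuw∈) (σvu∈colours-u symmetric uw)

  reaches : ∀ (t : KV k) v → Acc _⊂_ (missing G σ v ─ proj₁ t) → ∃[ w ] missingVertex w ≡ t
  reaches t v (acc smaller) with ≡-dec _≟ᵇ_ (missing G σ v) (proj₁ t)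
  ... | yes missing[v]≡t = v , KV-≡ missing[v]≡t
  ... | no  missing[v]≢t with ∃closer t v missing[v]≢t
  ...   | w , w-closer = reaches t w (smaller w-closer)

  isCovering : Fin n → IsCovering G (Kadj k) missingVertex
  isCovering v₀ = record
    { hom        = hom
    ; surjective = strictlySurjective⇒surjective λ t → reaches t v₀ (⊂-wellFounded _)
    ; localBij   = λ v → edgeMap-injective v , edgeMap-surjective v
    }

module _ (G : FinGraph n) (σ τ : Colouring n m) where

  private
    module Cσ = ColourSets G σ
    module Cτ = ColourSets G τ

  colours-pullback : ∀ {α : Fin n → Fin n} → Automorphism G α →
                     (∀ u v → T (adj G u v) → τ u v ≡ σ (α u) (α v)) →
                     ∀ v → colours G τ v ≡ colours G σ (α v)
  colours-pullback {α} ((_ , α-surjective) , α-adj) τ≡σ∘α v = ⊆-antisym τ⊆σ σ⊆τ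
    where
    τ⊆σ : colours G τ v ⊆ colours G σ (α v)
    τ⊆σ c∈ with to Cτ.∈-colours c∈
    ... | u , vu , refl = from Cσ.∈-colours (α u , subst T (α-adj v u) vu , sym (τ≡σ∘α v u vu))
    σ⊆τ : colours G σ (α v) ⊆ colours G τ v
    σ⊆τ c∈ with to Cσ.∈-colours c∈
    ... | u′ , αv-u′ , refl with α-surjective u′
    ...   | u , αu≡u′ with αu≡u′ refl
    ...     | refl = from Cτ.∈-colours (u , vu , τ≡σ∘α v u vu)
      where vu = subst T (sym (α-adj v u)) αv-u′

  colouring-pullback : StrongEdgeColouring G σ → IsEdgeColouring G τ →
                       ∀ {β : Fin n → Fin n} → (∀ u v → adj G u v ≡ adj G (β u) (β v)) →
                       (∀ v → colours G τ v ≡ colours G σ (β v)) →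
                       ∀ u v → T (adj G u v) → τ u v ≡ σ (β u) (β v)
  colouring-pullback σ-strong τ-symmetric β-adj colours≡ u v uv =
    Cσ.shared-colour σ-strong (subst T (β-adj u v) uv)
      (subst (τ u v ∈_) (colours≡ u) (Cτ.σvu∈colours-v uv))
      (subst (τ u v ∈_) (colours≡ v) (Cτ.σvu∈colours-u τ-symmetric uv))

theorem7 : (k : ℕ) → 3 ≤ k → (n : ℕ) → 1 ≤ n → (G : FinGraph n) → Regular k G →
    ((σ : Colouring n (2 * k ∸ 1)) → StrongEdgeColouring G σ →
      Σ[ f ∈ (Fin n → KV k) ]
        ((∀ v → proj₁ (f v) ≡ missing G σ v) × IsCovering G (Kadj k) f))
    ×
    ((σ τ : Colouring n (2 * k ∸ 1)) → StrongEdgeColouring G σ → StrongEdgeColouring G τ →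
      (fσ fτ : Fin n → KV k) →
      (∀ v → proj₁ (fσ v) ≡ missing G σ v) →
      (∀ v → proj₁ (fτ v) ≡ missing G τ v) →
      (EquivColourings G σ τ ⇔ EquivCoverings G fσ fτ))
theorem7 k 3≤k (suc n) _ G regular =
  (λ σ σ-strong → missingVertex σ σ-strong , (λ _ → refl) , isCovering σ σ-strong zero) ,
  λ σ τ σ-strong τ-strong fσ fτ fσ≡missing fτ≡missing → mk⇔
    (λ { (α , α-aut , τ≡σ∘α) → α , α-aut , λ v → KV-≡ (begin
       proj₁ (fτ v)         ≡⟨ fτ≡missing v ⟩
       missing G τ v        ≡⟨ from (missing≡⇔colours≡ G τ σ v (α v))
                                 (colours-pullback G σ τ α-aut τ≡σ∘α v) ⟩
       missing G σ (α v)    ≡⟨ fσ≡missing (α v) ⟨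
       proj₁ (fσ (α v))     ∎) })
    (λ { (β , β-aut , fτ≡fσ∘β) → β , β-aut ,
       colouring-pullback G σ τ σ-strong (proj₁ τ-strong) (proj₂ β-aut) λ v →
         to (missing≡⇔colours≡ G τ σ v (β v)) (begin
           missing G τ v        ≡⟨ fτ≡missing v ⟨
           proj₁ (fτ v)         ≡⟨ cong proj₁ (fτ≡fσ∘β v) ⟩
           proj₁ (fσ (β v))     ≡⟨ fσ≡missing (β v) ⟩
           missing G σ (β v)    ∎) })
  where
  -- the argument only needs k ≥ 1
  open Covering k (≤-trans (s≤s z≤n) 3≤k) G regular
  open Kneser k using (KV-≡)
  open ≡-Reasoning
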